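{- Let $G$ be the cube graph. Then $B_2(G)=2$ and $T_2(G)=3$, and these values are achieved simultaneously by the same pot, i.e. there is a pot $P$ satisfying Scenario 2 for $G$ with $\#P=3$ and $\#\Sigma(P)=2$.
   Context: The cube graph is the 1-skeleton of the 3-dimensional cube ($3$-regular, $8$ vertices). Graphs are finite and may have loops and multiple edges; each edge $e$ with endpoints $u,v$ has half-edges $(u,e),(v,e)$. Fix a finite alphabet $\Sigma$ (bond-edge types) and disjoint copy $\hat\Sigma=\{\hat a:a\in\Sigma\}$; elements of $\Sigma\cup\hat\Sigma$ are cohesive-end types, $\hat{\hat a}=a$. A tile is a finite multiset of cohesive-end types. A pot is a finite set $P$ of tiles such that whenever $x$ occurs in a tile of $P$, $\hat x$ occurs in some tile of $P$; $\#P$ is the number of tiles and $\#\Sigma(P)$ the number of $a\in\Sigma$ such that $a$ or $\hat a$ occurs in a tile of $P$. An assembly design of $G$ labels half-edges by cohesive-end types so that the two half-edges of each edge receive $a$ and $\hat a$ for some $a\in\Sigma$; $\lambda(v)$ is the multiset of labels at $v$ and $P_\lambda(G)=\{\lambda(v)\}$. $P$ realizes $G$ if $P_\lambda(G)\subseteq P$ for some assembly design $\lambda$; $\mathcal O(P)$ is the set of graphs realized by $P$. Scenario 1 for $G$: $G\in\mathcal O(P)$. Scenario 2: Scenario 1 and every $H\in\mathcal O(P)$ has $\#V(H)\ge\#V(G)$. Scenario 3: Scenario 2 and every $H\in\mathcal O(P)$ with $\#V(H)=\#V(G)$ is isomorphic to $G$. $T_i(G)=\min\{\#P: P$ satisfies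 Scenario $i$ for $G\}$ and $B_i(G)=\min\{\#\Sigma(P): P$ satisfies Scenario $i$ for $G\}$. -}

module Defs where

open import Data.Nat using (ℕ; suc; _≥_) renaming (_≟_ to _≟ℕ_)
open import Data.Bool using (Bool; true; false; not)
open import Data.Fin using (Fin; #_) renaming (_≟_ to _≟F_)
open import Data.Product using (_×_; _,_; proj₁; ∃; ∃-syntax; Σ-syntax)
open import Data.List using (List; []; _∷_; _++_; concatMap; concat; map; length; deduplicate; allFin)
open import Data.List.Membership.Propositional using (_∈_)
open import Data.List.Relation.Unary.AllPairs using (AllPairs)
open import Data.List.Relation.Binary.Permutation.Propositional using (_↭_)
open import Data.Vec using (Vec; lookup; []; _∷_)

open import Relation.Nullary using (¬_; yes; no)

-- Bond-edge types: the alphabet Σ is taken to be ℕ (any pot uses only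
-- finitely many letters).  A cohesive-end type is (a , false) = a or
-- (a , true) = â.

BondEdgeType : Set
BondEdgeType = ℕ

CohesiveEnd : Set
CohesiveEnd = BondEdgeType × Bool

hat : CohesiveEnd → CohesiveEnd
hat (a , b) = (a , not b)

-- A tile is a finite multiset of cohesive-end types: a list, considered
-- up to permutation (_↭_).
Tile : Set
Tile = List CohesiveEnd

record Pot : Set where
  field
    tiles    : List Tile
    distinct : AllPairs (λ s t → ¬ (s ↭ t)) tiles
    closed   : ∀ t x → t ∈ tiles → x ∈ t → ∃[ t' ] (t' ∈ tiles × hat x ∈ t')
open Pot public

#T : Pot → ℕ
#T P = length (tiles P)

#Σ : Pot → ℕ
#Σ P = length (deduplicate _≟ℕ_ (map proj₁ (concat (tiles P))))

-- Finite graphs, loops and multiple edges allowed.  Edge e has endpoints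
-- ends e = (u , w); its half-edges are (u , e) and (w , e).
record Graph : Set where
  field
    nV   : ℕ
    nE   : ℕ
    ends : Fin nE → Fin nV × Fin nV
open Graph public

-- An assembly design assigns to each edge e the label of its first
-- half-edge (u , e); the second half-edge (w , e) then receives the
-- complementary type (a ↦ â, â ↦ a), as required.
AssemblyDesign : Graph → Set
AssemblyDesign G = Fin (nE G) → CohesiveEnd

labelsAt : (G : Graph) → AssemblyDesign G → Fin (nV G) → Tile
labelsAt G ℓ v = concatMap half (allFin (nE G))
  where
  half : Fin (nE G) → List CohesiveEnd
  half e with ends G e
  ... | (u , w) = first u ++ second w
    where
    first : Fin (nV G) → List CohesiveEnd
    first u with u ≟F v
    ... | yes _ = ℓ e ∷ []
    ... | no  _ = []
    second : Fin (nV G) → List CohesiveEnd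
    second w with w ≟F v
    ... | yes _ = hat (ℓ e) ∷ []
    ... | no  _ = []

Realizes : Pot → Graph → Set
Realizes P G =
  Σ[ ℓ ∈ AssemblyDesign G ] (∀ v → ∃[ t ] (t ∈ tiles P × labelsAt G ℓ v ↭ t))

-- Scenario 2.  Graphs H in O(P) range over nonempty graphs (the empty
-- graph is trivially realized by every pot).
Scenario2 : Pot → Graph → Set
Scenario2 P G =
  Realizes P G × (∀ (H : Graph) → nV H ≥ 1 → Realizes P H → nV H ≥ nV G)

-- The cube graph Q₃: vertices = 3-bit strings 0..7, edges join strings
-- differing in exactly one bit.
cubeEdges : Vec (Fin 8 × Fin 8) 12
cubeEdges =
  (# 0 , # 1) ∷ (# 2 , # 3) ∷ (# 4 , # 5) ∷ (# 6 , # 7) ∷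
  (# 0 , # 2) ∷ (# 1 , # 3) ∷ (# 4 , # 6) ∷ (# 5 , # 7) ∷
  (# 0 , # 4) ∷ (# 1 , # 5) ∷ (# 2 , # 6) ∷ (# 3 , # 7) ∷ []

cube : Graph
cube = record { nV = 8 ; nE = 12 ; ends = lookup cubeEdges }

-- Every edge of a realized graph carries one end a and one end â, so the multiset union of
-- the vertex tiles is balanced: each cohesive-end type occurs as often as its complement.
-- Conversely, matching complementary ends one edge at a time, every finite family of tiles
-- with balanced union is the family of vertex tiles of a graph on that many vertices. So a
-- pot realizing the cube satisfies Scenario 2 iff no nonempty family of fewer than 8 of its tiles
-- (repetitions allowed) is balanced.
--
-- For P₀ = {A³, ÂB², ÂB̂²} with multiplicities s₁, s₂, s₃, balance at A and at B says
-- 3s₁ = s₂ + s₃ and s₂ = s₃; hence s₁ is even and the number of vertices 4s₁ is a multiple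
-- of 8. If a pot has at most two tiles, the 8 vertex tiles of the cube (each of size 3)
-- split as m + m′ between two kinds; dividing (m, m′) by gcd(m, 8), or for odd m using that
-- every count is at most 3, gives a smaller balanced family. If a pot uses a single
-- bond-edge type a, the vertex tiles cannot all have more a than â, nor all fewer, and some
-- combination of at most four copies of one tile of each sort is balanced.
{-# OPTIONS --safe #-}
module Submission where

open import Defs
open import Data.Bool using (true; false; if_then_else_) renaming (_≟_ to _≟ᵇ_)
open import Data.Bool.Properties using (not-involutive)
open import Data.Empty using (⊥; ⊥-elim)
open import Data.Fin using (Fin; zero; suc) renaming (_≟_ to _≟ᶠ_)
open import Data.Fin.Properties using (any?; all?; ¬∀⟶∃¬)
open import Data.List using (List; []; _∷_; _++_; length; filter; concat; concatMap; map; tabulate; allFin; lookup; replicate; deduplicate)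
open import Data.List.Properties using (filter-++; length-++; length-filter; filter-accept; filter-reject; concat-++; map-tabulate; map-cong; tabulate-lookup; length-tabulate; length-replicate; ++-assoc) renaming (≡-dec to ≡-decᴸ)
open import Data.List.Membership.Propositional using (_∈_; _∉_)
open import Data.List.Membership.Propositional.Properties using (∈-filter⁻; ∈-∃++; ∈-concat⁺′; ∈-concat⁻′; ∈-tabulate⁻; ∈-lookup; ∈-map⁺; ∈-deduplicate⁺)
open import Data.List.Relation.Unary.All as All using (All; []; _∷_)
open import Data.List.Relation.Unary.All.Properties using (tabulate⁺; replicate⁺) renaming (++⁺ to All-++⁺)
open import Data.List.Relation.Unary.AllPairs using ([]; _∷_)
open import Data.List.Relation.Unary.Any as Any using (here; there)
open import Data.List.Relation.Binary.Permutation.Propositional using (_↭_; ↭-refl; ↭-sym; ↭-trans; ↭-reflexive; prep; swap)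
open import Data.List.Relation.Binary.Permutation.Propositional.Properties using (↭-length; filter-↭; shift; shifts; ++⁺; ++⁺ˡ; ∈-resp-↭)
open import Data.Nat using (ℕ; zero; suc; _+_; _*_; _∸_; _≤_; _<_; _≥_; s≤s; z≤n; _≤?_; _<?_; >-nonZero) renaming (_≟_ to _≟ℕ_)
open import Data.Nat.Coprimality using (coprime?; coprime-divisor)
open import Data.Nat.Divisibility using (_∣_; divides; ∣⇒≤)
open import Data.Nat.Induction using (<-wellFounded)
open import Data.Nat.Properties using (+-cancelˡ-≡; *-cancelʳ-≡; *-comm; +-suc; ≤-refl; ≤-trans; ≤-pred; m≤n⇒m≤1+n; m≤m+n; m∸n≤m; m+n∸m≡n; m+n∸n≡m; +-mono-≤; +-mono-<-≤; <⇒≤; <⇒≢; <⇒≱; ≮⇒≥; ≰⇒>; allUpTo?)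
open import Data.Nat.Tactic.RingSolver using (solve-∀)
open import Data.Product using (_×_; _,_; proj₁; proj₂; ∃₂; ∃-syntax; Σ-syntax)
open import Data.Product.Properties using (≡-dec)
open import Data.Sum using (_⊎_; inj₁; inj₂) renaming (map to ⊎-map)
open import Data.Vec using () renaming ([] to []ᵛ; _∷_ to _∷ᵛ_; lookup to lookupᵛ)
open import Data.Vec.Functional using () renaming (_∷_ to _◂_)
open import Function using (_∘_)
open import Induction.WellFounded using (Acc; acc)
open import Relation.Binary.Definitions using (DecidableEquality)
open import Relation.Binary.PropositionalEquality
open import Relation.Nullary using (¬_; Dec; does; yes; no)
open import Relation.Nullary.Decidable using (from-yes; _×-dec_; _→-dec_)

hat-involutive : ∀ x → hat (hat x) ≡ x
hat-involutive (a , b) = cong (a ,_) (not-involutive b)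

hat-injective : ∀ {x y} → hat x ≡ hat y → x ≡ y
hat-injective {x} {y} eq = trans (sym (hat-involutive x)) (trans (cong hat eq) (hat-involutive y))

hat≢id : ∀ x → hat x ≢ x
hat≢id (a , false) ()
hat≢id (a , true) ()

_≟ᶜ_ : DecidableEquality CohesiveEnd
_≟ᶜ_ = ≡-dec _≟ℕ_ _≟ᵇ_

count : CohesiveEnd → List CohesiveEnd → ℕ
count x xs = length (filter (x ≟ᶜ_) xs)

count-↭ : ∀ x {xs ys} → xs ↭ ys → count x xs ≡ count x ys
count-↭ x p = ↭-length (filter-↭ (x ≟ᶜ_) p)

count-++ : ∀ x xs ys → count x (xs ++ ys) ≡ count x xs + count x ys
count-++ x xs ys = trans (cong length (filter-++ (x ≟ᶜ_) xs ys)) (length-++ (filter (x ≟ᶜ_) xs))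

count≤length : ∀ x xs → count x xs ≤ length xs
count≤length x = length-filter (x ≟ᶜ_)

count-hat : ∀ x xs → count (hat x) (map hat xs) ≡ count x xs
count-hat x [] = refl
count-hat x (y ∷ ys) with x ≟ᶜ y | hat x ≟ᶜ hat y
... | yes _ | yes _ = cong suc (count-hat x ys)
... | no _ | no _ = count-hat x ys
... | yes x≡y | no hx≢hy = ⊥-elim (hx≢hy (cong hat x≡y))
... | no x≢y | yes hx≡hy = ⊥-elim (x≢y (hat-injective hx≡hy))

count-∷-≡ : ∀ x xs → count x (x ∷ xs) ≡ suc (count x xs)
count-∷-≡ x xs = cong length (filter-accept (x ≟ᶜ_) refl)

count-∷-≢ : ∀ {x y} xs → x ≢ y → count x (y ∷ xs) ≡ count x xs
count-∷-≢ {x} xs x≢y = cong length (filter-reject (x ≟ᶜ_) x≢y)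

0<count⇒∈ : ∀ {x} xs → 0 < count x xs → x ∈ xs
0<count⇒∈ {x} xs pos with filter (x ≟ᶜ_) xs in eq
... | y ∷ _ with ∈-filter⁻ (x ≟ᶜ_) (subst (y ∈_) (sym eq) (here refl))
... | y∈xs , x≡y = subst (_∈ xs) (sym x≡y) y∈xs

Balanced : List CohesiveEnd → Set
Balanced xs = ∀ x → count x xs ≡ count (hat x) xs

Balanced-↭ : ∀ {xs ys} → xs ↭ ys → Balanced xs → Balanced ys
Balanced-↭ p bal x = trans (sym (count-↭ x p)) (trans (bal x) (count-↭ (hat x) p))

Balanced-++ : ∀ {xs ys} → Balanced xs → Balanced ys → Balanced (xs ++ ys)
Balanced-++ {xs} {ys} bx by x = trans (count-++ x xs ys)
  (trans (cong₂ _+_ (bx x) (by x)) (sym (count-++ (hat x) xs ys)))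

Balanced-++⁻ : ∀ {xs ys} → Balanced xs → Balanced (xs ++ ys) → Balanced ys
Balanced-++⁻ {xs} {ys} bx bxy x = +-cancelˡ-≡ (count x xs) (count x ys) (count (hat x) ys)
  (trans (sym (count-++ x xs ys)) (trans (bxy x) (trans (count-++ (hat x) xs ys) (cong (_+ count (hat x) ys) (sym (bx x))))))

Balanced-pair : ∀ x → Balanced (x ∷ hat x ∷ [])
Balanced-pair x y = begin
  count y (x ∷ hat x ∷ [])                 ≡⟨ count-↭ y (swap x (hat x) ↭-refl) ⟩
  count y (hat x ∷ x ∷ [])                 ≡⟨ sym (count-hat y (hat x ∷ x ∷ [])) ⟩
  count (hat y) (hat (hat x) ∷ hat x ∷ [])  ≡⟨ cong (λ z → count (hat y) (z ∷ hat x ∷ [])) (hat-involutive x) ⟩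
  count (hat y) (x ∷ hat x ∷ [])           ∎
  where open ≡-Reasoning

Balanced-∷⇒hat∈ : ∀ {x xs} → Balanced (x ∷ xs) → hat x ∈ xs
Balanced-∷⇒hat∈ {x} {xs} bal = 0<count⇒∈ xs (subst (0 <_) counts (s≤s z≤n))
  where
  counts : suc (count x xs) ≡ count (hat x) xs
  counts = begin
    suc (count x xs)         ≡⟨ sym (count-∷-≡ x xs) ⟩
    count x (x ∷ xs)         ≡⟨ bal x ⟩
    count (hat x) (x ∷ xs)   ≡⟨ count-∷-≢ xs (hat≢id x) ⟩
    count (hat x) xs         ∎
    where open ≡-Reasoning

insertAt : ∀ {k} → Fin k → CohesiveEnd → (Fin k → Tile) → Fin k → Tile
insertAt i x ts v = if does (i ≟ᶠ v) then x ∷ ts v else ts v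

insertAt-↭ : ∀ {k} i x {ts ts′ : Fin k → Tile} → (∀ v → ts v ↭ ts′ v) →
  ∀ v → insertAt i x ts v ↭ insertAt i x ts′ v
insertAt-↭ i x p v with does (i ≟ᶠ v)
... | true = prep x (p v)
... | false = p v

insertAt₂-++ : ∀ {k} i x j y (ts : Fin k → Tile) v →
  insertAt i x (insertAt j y (λ _ → [])) v ++ ts v ≡ insertAt i x (insertAt j y ts) v
insertAt₂-++ i x j y ts v with does (i ≟ᶠ v) | does (j ≟ᶠ v)
... | true | true = refl
... | true | false = refl
... | false | true = refl
... | false | false = refl

total : ∀ {k} → (Fin k → Tile) → List CohesiveEnd
total ts = concat (tabulate ts)

total-↭ : ∀ {k} {ts ts′ : Fin k → Tile} → (∀ v → ts v ↭ ts′ v) → total ts ↭ total ts′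
total-↭ {zero} p = ↭-refl
total-↭ {suc k} p = ++⁺ (p zero) (total-↭ (p ∘ suc))

total-insertAt : ∀ {k} i x (ts : Fin k → Tile) → total (insertAt i x ts) ↭ x ∷ total ts
total-insertAt zero x ts = ↭-refl
total-insertAt (suc i) x ts =
  ↭-trans (++⁺ˡ (ts zero) (total-insertAt i x (ts ∘ suc))) (shift x (ts zero) (total (ts ∘ suc)))

total-insertAt₂ : ∀ {k} i x j y (ts : Fin k → Tile) → total (insertAt i x (insertAt j y ts)) ↭ x ∷ y ∷ total ts
total-insertAt₂ i x j y ts = ↭-trans (total-insertAt i x _) (prep x (total-insertAt j y ts))

total-[] : ∀ k → total {k} (λ _ → []) ≡ []
total-[] zero = refl
total-[] (suc k) = total-[] k

pullOut : ∀ {k} {ts : Fin k → Tile} {i x} → x ∈ ts i → ∃[ ts′ ] (∀ v → ts v ↭ insertAt i x ts′ v)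
pullOut {ts = ts} {i} {x} x∈ with ∈-∃++ x∈
... | ys , zs , tsᵢ≡ = (λ v → if does (i ≟ᶠ v) then ys ++ zs else ts v) , removed
  where
  removed : ∀ v → ts v ↭ insertAt i x (λ v → if does (i ≟ᶠ v) then ys ++ zs else ts v) v
  removed v with i ≟ᶠ v
  ... | yes refl = ↭-trans (↭-reflexive tsᵢ≡) (shift x ys zs)
  ... | no _ = ↭-refl


graphOn : ∀ {k n} → (Fin n → Fin k × Fin k) → Graph
graphOn {k} {n} en = record { nV = k ; nE = n ; ends = en }

edgeLabelsAt : (G : Graph) → AssemblyDesign G → Fin (nV G) → Fin (nE G) → Tile
edgeLabelsAt G ℓ v e = insertAt (proj₁ (ends G e)) (ℓ e) (insertAt (proj₂ (ends G e)) (hat (ℓ e)) (λ _ → [])) v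

labelsAt-byEdge : ∀ G ℓ v → labelsAt G ℓ v ≡ concatMap (edgeLabelsAt G ℓ v) (allFin (nE G))
labelsAt-byEdge G ℓ v = cong concat (map-cong edge (allFin (nE G)))
  where
  -- Defs builds labelsAt from a local function; summand recovers it by unification.
  summand : ∀ {n} {h : Fin n → Tile} {xs} → concatMap h (allFin n) ≡ xs → Fin n → Tile
  summand {h = h} _ = h
  edge : ∀ e → summand {xs = labelsAt G ℓ v} refl e ≡ edgeLabelsAt G ℓ v e
  edge e with proj₁ (ends G e) ≟ᶠ v | proj₂ (ends G e) ≟ᶠ v
  ... | yes _ | yes _ = refl
  ... | yes _ | no _ = refl
  ... | no _ | yes _ = refl
  ... | no _ | no _ = refl

labelsAt-firstEdge : ∀ {k n} (en : Fin (suc n) → Fin k × Fin k) (ℓ : Fin (suc n) → CohesiveEnd) v →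
  labelsAt (graphOn en) ℓ v ≡
    insertAt (proj₁ (en zero)) (ℓ zero) (insertAt (proj₂ (en zero)) (hat (ℓ zero)) (labelsAt (graphOn (en ∘ suc)) (ℓ ∘ suc))) v
labelsAt-firstEdge {n = n} en ℓ v = begin
  labelsAt (graphOn en) ℓ v
    ≡⟨ labelsAt-byEdge (graphOn en) ℓ v ⟩
  edgeLabelsAt (graphOn en) ℓ v zero ++ concat (map (edgeLabelsAt (graphOn en) ℓ v) (tabulate suc))
    ≡⟨ cong (λ es → edgeLabelsAt (graphOn en) ℓ v zero ++ concat es) restEdges ⟩
  edgeLabelsAt (graphOn en) ℓ v zero ++ concatMap (edgeLabelsAt (graphOn (en ∘ suc)) (ℓ ∘ suc) v) (allFin n)
    ≡⟨ cong (edgeLabelsAt (graphOn en) ℓ v zero ++_) (sym (labelsAt-byEdge (graphOn (en ∘ suc)) (ℓ ∘ suc) v)) ⟩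
  edgeLabelsAt (graphOn en) ℓ v zero ++ labelsAt (graphOn (en ∘ suc)) (ℓ ∘ suc) v
    ≡⟨ insertAt₂-++ (proj₁ (en zero)) (ℓ zero) (proj₂ (en zero)) (hat (ℓ zero)) (labelsAt (graphOn (en ∘ suc)) (ℓ ∘ suc)) v ⟩
  insertAt (proj₁ (en zero)) (ℓ zero) (insertAt (proj₂ (en zero)) (hat (ℓ zero)) (labelsAt (graphOn (en ∘ suc)) (ℓ ∘ suc))) v ∎
  where
  open ≡-Reasoning
  restEdges : map (edgeLabelsAt (graphOn en) ℓ v) (tabulate suc) ≡ map (edgeLabelsAt (graphOn (en ∘ suc)) (ℓ ∘ suc) v) (allFin n)
  restEdges = trans (map-tabulate suc _) (sym (map-tabulate (λ e → e) _))

handshake : ∀ G ℓ → Balanced (total (labelsAt G ℓ))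
handshake G = byEdges (ends G)
  where
  byEdges : ∀ {k n} (en : Fin n → Fin k × Fin k) ℓ → Balanced (total (labelsAt (graphOn en) ℓ))
  byEdges {k} {zero} en ℓ rewrite total-[] k = λ _ → refl
  byEdges {k} {suc n} en ℓ =
    Balanced-↭ (↭-sym (↭-trans (total-↭ (↭-reflexive ∘ labelsAt-firstEdge en ℓ))
                                (total-insertAt₂ (proj₁ (en zero)) (ℓ zero) (proj₂ (en zero)) (hat (ℓ zero)) _)))
      (Balanced-++ {xs = ℓ zero ∷ hat (ℓ zero) ∷ []} (Balanced-pair (ℓ zero)) (byEdges (en ∘ suc) (ℓ ∘ suc)))

record Realization {k} (ts : Fin k → Tile) : Set where
  field
    {nEdges} : ℕ
    edges    : Fin nEdges → Fin k × Fin k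
    design   : Fin nEdges → CohesiveEnd
    labels   : ∀ v → labelsAt (graphOn edges) design v ↭ ts v
open Realization

Realization-↭ : ∀ {k} {ts ts′ : Fin k → Tile} → (∀ v → ts v ↭ ts′ v) → Realization ts → Realization ts′
Realization-↭ p R = record { edges = edges R ; design = design R ; labels = λ v → ↭-trans (labels R v) (p v) }

Realization-[] : ∀ {k} {ts : Fin k → Tile} → (∀ v → ts v ≡ []) → Realization ts
Realization-[] empty = record { nEdges = 0 ; edges = λ () ; design = λ () ; labels = λ v → ↭-reflexive (sym (empty v)) }

Realization-addEdge : ∀ {k} {ts : Fin k → Tile} i j x → Realization ts →
  Realization (insertAt i x (insertAt j (hat x) ts))
Realization-addEdge i j x R = record
  { edges  = (i , j) ◂ edges R
  ; design = x ◂ design R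
  ; labels = λ v → ↭-trans (↭-reflexive (labelsAt-firstEdge ((i , j) ◂ edges R) (x ◂ design R) v))
                           (insertAt-↭ i x (insertAt-↭ j (hat x) (labels R)) v)
  }

someEnd : ∀ {k} (ts : Fin k → Tile) → (∀ v → ts v ≡ []) ⊎ ∃₂ λ i x → x ∈ ts i
someEnd {zero} ts = inj₁ λ ()
someEnd {suc k} ts with ts zero in eq | someEnd (ts ∘ suc)
... | x ∷ _ | _ = inj₂ (zero , x , subst (x ∈_) (sym eq) (here refl))
... | [] | inj₂ (i , x , x∈) = inj₂ (suc i , x , x∈)
... | [] | inj₁ empty = inj₁ λ { zero → eq ; (suc v) → empty v }

splitEdge : ∀ {k} {ts : Fin k → Tile} {i x} → Balanced (total ts) → x ∈ ts i →
  ∃₂ λ j ts′ → ∀ v → ts v ↭ insertAt i x (insertAt j (hat x) ts′) v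
splitEdge {ts = ts} {i} {x} bal x∈ with pullOut x∈
... | ts₁ , ts≈
  with ∈-concat⁻′ (tabulate ts₁) (Balanced-∷⇒hat∈ (Balanced-↭ (↭-trans (total-↭ ts≈) (total-insertAt i x ts₁)) bal))
... | t , hx∈t , t∈ with ∈-tabulate⁻ t∈
... | j , refl with pullOut hx∈t
... | ts₂ , ts₁≈ = j , ts₂ , λ v → ↭-trans (ts≈ v) (insertAt-↭ i x ts₁≈ v)

Balanced⇒Realization : ∀ {k} (ts : Fin k → Tile) → Balanced (total ts) → Realization ts
Balanced⇒Realization ts = build ts (<-wellFounded _)
  where
  build : ∀ {k} (ts : Fin k → Tile) → Acc _<_ (length (total ts)) → Balanced (total ts) → Realization ts
  build ts (acc smaller) bal with someEnd ts
  ... | inj₁ empty = Realization-[] empty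
  ... | inj₂ (i , x , x∈) with splitEdge bal x∈
  ... | j , ts′ , ts≈ =
    Realization-↭ (↭-sym ∘ ts≈) (Realization-addEdge i j x (build ts′ (smaller shorter) bal′))
    where
    rearranged : total ts ↭ x ∷ hat x ∷ total ts′
    rearranged = ↭-trans (total-↭ ts≈) (total-insertAt₂ i x j (hat x) ts′)
    shorter : length (total ts′) < length (total ts)
    shorter = subst (length (total ts′) <_) (sym (↭-length rearranged)) (m≤n⇒m≤1+n ≤-refl)
    bal′ : Balanced (total ts′)
    bal′ = Balanced-++⁻ {xs = x ∷ hat x ∷ []} (Balanced-pair x) (Balanced-↭ rearranged bal)

PotTile : Pot → Tile → Set
PotTile P s = ∃[ t ] (t ∈ tiles P × s ↭ t)

family-bound : ∀ {P G} → Scenario2 P G → (ss : List Tile) → 1 ≤ length ss → All (PotTile P) ss →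
  Balanced (concat ss) → nV G ≤ length ss
family-bound {P} (_ , minimal) ss nonempty fromPot bal = minimal (graphOn (edges R)) nonempty (design R , fits)
  where
  R : Realization (lookup ss)
  R = Balanced⇒Realization (lookup ss) (subst Balanced (cong concat (sym (tabulate-lookup ss))) bal)
  fits : ∀ v → PotTile P (labelsAt (graphOn (edges R)) (design R) v)
  fits v with All.lookup fromPot (∈-lookup v)
  ... | t , t∈ , s↭t = t , t∈ , ↭-trans (labels R v) s↭t

count-replicate : ∀ x p s → count x (concat (replicate p s)) ≡ p * count x s
count-replicate x zero s = refl
count-replicate x (suc p) s = trans (count-++ x s _) (cong (count x s +_) (count-replicate x p s))

count-copies : ∀ x p s q t → count x (concat (replicate p s ++ replicate q t)) ≡ p * count x s + q * count x t
count-copies x p s q t = begin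
  count x (concat (replicate p s ++ replicate q t))
    ≡⟨ cong (count x) (sym (concat-++ (replicate p s) (replicate q t))) ⟩
  count x (concat (replicate p s) ++ concat (replicate q t))
    ≡⟨ count-++ x (concat (replicate p s)) _ ⟩
  count x (concat (replicate p s)) + count x (concat (replicate q t))
    ≡⟨ cong₂ _+_ (count-replicate x p s) (count-replicate x q t) ⟩
  p * count x s + q * count x t ∎
  where open ≡-Reasoning

split-kind : ∀ {Q : Tile → Set} {s} (ss : List Tile) → All (λ r → r ↭ s ⊎ Q r) ss →
  ∃₂ λ p rest → All Q rest × p + length rest ≡ length ss × concat ss ↭ concat (replicate p s) ++ concat rest
split-kind [] [] = 0 , [] , [] , refl , ↭-refl
split-kind {s = s} (r ∷ ss) (inj₁ r↭s ∷ kinds) with split-kind ss kinds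
... | p , rest , qs , len , perm = suc p , rest , qs , cong suc len ,
  ↭-trans (++⁺ r↭s perm) (↭-reflexive (sym (++-assoc s _ _)))
split-kind {s = s} (r ∷ ss) (inj₂ q ∷ kinds) with split-kind ss kinds
... | p , rest , qs , len , perm = p , r ∷ rest , q ∷ qs , trans (+-suc p (length rest)) (cong suc len) ,
  ↭-trans (++⁺ˡ r perm) (shifts r (concat (replicate p s)))

all-kind : ∀ {t} (ss : List Tile) → All (_↭ t) ss → concat ss ↭ concat (replicate (length ss) t)
all-kind [] [] = ↭-refl
all-kind (r ∷ ss) (r↭t ∷ rs) = ++⁺ r↭t (all-kind ss rs)

two-kinds : ∀ {s t} (ss : List Tile) → All (λ r → r ↭ s ⊎ r ↭ t) ss →
  ∃₂ λ p q → p + q ≡ length ss × concat ss ↭ concat (replicate p s) ++ concat (replicate q t)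
two-kinds ss kinds with split-kind ss kinds
... | p , rest , ts , len , perm = p , length rest , len , ↭-trans perm (++⁺ˡ _ (all-kind rest ts))

count-concat-≤ : ∀ x y (ss : List Tile) → All (λ s → count x s ≤ count y s) ss →
  count x (concat ss) ≤ count y (concat ss)
count-concat-≤ x y [] [] = z≤n
count-concat-≤ x y (s ∷ ss) (le ∷ les) =
  subst₂ _≤_ (sym (count-++ x s (concat ss))) (sym (count-++ y s (concat ss))) (+-mono-≤ le (count-concat-≤ x y ss les))

count-concat-< : ∀ x y s (ss : List Tile) → All (λ r → count x r < count y r) (s ∷ ss) →
  count x (concat (s ∷ ss)) < count y (concat (s ∷ ss))
count-concat-< x y s ss (lt ∷ lts) =
  subst₂ _<_ (sym (count-++ x s (concat ss))) (sym (count-++ y s (concat ss)))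
    (+-mono-<-≤ lt (count-concat-≤ x y ss (All.map <⇒≤ lts)))

count-∉ : ∀ {x} xs → x ∉ xs → count x xs ≡ 0
count-∉ {x} xs x∉ with count x xs in eq
... | zero = refl
... | suc _ = ⊥-elim (x∉ (0<count⇒∈ xs (subst (0 <_) (sym eq) (s≤s z≤n))))

OneLetter : BondEdgeType → List CohesiveEnd → Set
OneLetter a xs = ∀ {y} → y ∈ xs → proj₁ y ≡ a

count-OneLetter : ∀ {a} xs → OneLetter a xs → count (a , false) xs + count (a , true) xs ≡ length xs
count-OneLetter [] _ = refl
count-OneLetter {a} ((b , s) ∷ xs) one with one (here refl)
count-OneLetter {a} ((a , false) ∷ xs) one | refl =
  trans (cong₂ _+_ (count-∷-≡ (a , false) xs) (count-∷-≢ xs (λ ()))) (cong suc (count-OneLetter xs (one ∘ there)))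
count-OneLetter {a} ((a , true) ∷ xs) one | refl =
  trans (cong₂ _+_ (count-∷-≢ xs (λ ())) (count-∷-≡ (a , true) xs))
        (trans (+-suc _ _) (cong suc (count-OneLetter xs (one ∘ there))))

OneLetter-concat : ∀ {a ss} → All (OneLetter a) ss → OneLetter a (concat ss)
OneLetter-concat {ss = ss} ones y∈ with ∈-concat⁻′ ss y∈
... | t , y∈t , t∈ss = All.lookup ones t∈ss y∈t

OneLetter-Balanced : ∀ {a xs} → OneLetter a xs → count (a , false) xs ≡ count (a , true) xs → Balanced xs
OneLetter-Balanced {a} {xs} one eq (b , s) with b ≟ℕ a
OneLetter-Balanced {a} {xs} one eq (a , false) | yes refl = eq
OneLetter-Balanced {a} {xs} one eq (a , true) | yes refl = sym eq
... | no b≢a = trans (count-∉ xs (b≢a ∘ one)) (sym (count-∉ xs (b≢a ∘ one)))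

≤1-unique : ∀ {A : Set} {xs : List A} {a b} → length xs ≤ 1 → a ∈ xs → b ∈ xs → a ≡ b
≤1-unique {xs = _ ∷ []} _ (here refl) (here refl) = refl
≤1-unique {xs = _ ∷ _ ∷ _} (s≤s ())

≤2-dichotomy : ∀ {A : Set} {xs : List A} {a b c} → length xs ≤ 2 → a ∈ xs → b ∈ xs → a ≢ b →
  c ∈ xs → c ≡ a ⊎ c ≡ b
≤2-dichotomy {xs = _ ∷ []} _ (here refl) (here refl) a≢b _ = ⊥-elim (a≢b refl)
≤2-dichotomy {xs = _ ∷ _ ∷ []} _ (here refl) _ _ (here refl) = inj₁ refl
≤2-dichotomy {xs = _ ∷ _ ∷ []} _ (there (here refl)) _ _ (there (here refl)) = inj₁ refl
≤2-dichotomy {xs = _ ∷ _ ∷ []} _ _ (here refl) _ (here refl) = inj₂ refl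
≤2-dichotomy {xs = _ ∷ _ ∷ []} _ _ (there (here refl)) _ (there (here refl)) = inj₂ refl
≤2-dichotomy {xs = _ ∷ _ ∷ []} _ (here refl) (here refl) a≢b _ = ⊥-elim (a≢b refl)
≤2-dichotomy {xs = _ ∷ _ ∷ []} _ (there (here refl)) (there (here refl)) a≢b _ = ⊥-elim (a≢b refl)
≤2-dichotomy {xs = _ ∷ _ ∷ _ ∷ _} (s≤s (s≤s ()))

-- (m, 8 − m) divided by gcd(m, 8); for odd m the counts of a size-3 tile are too small
-- for the other kind to compensate, so one tile of the first kind is already balanced.
reducedMultiplicities : ℕ → ℕ × ℕ
reducedMultiplicities 0 = 0 , 1
reducedMultiplicities 2 = 1 , 3
reducedMultiplicities 4 = 1 , 1
reducedMultiplicities 6 = 3 , 1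
reducedMultiplicities _ = 1 , 0

Reduces : ℕ → ℕ → ℕ → ℕ → Set
Reduces m m′ p q = 1 ≤ p + q × p + q < 8 ×
  (∀ {a} → a < 4 → ∀ {a′} → a′ < 4 → ∀ {b} → b < 4 → ∀ {b′} → b′ < 4 →
     m * a + m′ * a′ ≡ m * b + m′ * b′ → p * a + q * a′ ≡ p * b + q * b′)

reduces? : ∀ m m′ p q → Dec (Reduces m m′ p q)
reduces? m m′ p q = (1 ≤? p + q) ×-dec (p + q <? 8) ×-dec
  allUpTo? (λ a → allUpTo? (λ a′ → allUpTo? (λ b → allUpTo? (λ b′ →
    (m * a + m′ * a′ ≟ℕ m * b + m′ * b′) →-dec (p * a + q * a′ ≟ℕ p * b + q * b′)) 4) 4) 4) 4

-- abstract, so that uses do not unfold the exhaustive check.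
abstract
  reduce-two-kinds : ∀ {m} → m < 9 → ∃₂ (Reduces m (8 ∸ m))
  reduce-two-kinds {m} m<9 = p m , q m , from-yes (allUpTo? (λ m → reduces? m (8 ∸ m) (p m) (q m)) 9) m<9
    where
    p q : ℕ → ℕ
    p = proj₁ ∘ reducedMultiplicities
    q = proj₂ ∘ reducedMultiplicities

oneLetterMultiplicities : ∀ {ku kw} → ku ≤ 1 → 2 ≤ kw → kw ≤ 3 →
  ∃₂ λ p q → 1 ≤ p + q × p + q < 8 × p * (3 ∸ ku) + q * (3 ∸ kw) ≡ p * ku + q * kw
oneLetterMultiplicities {0} {2} _ _ _ = 1 , 3 , from-yes (1 ≤? 4) , from-yes (4 <? 8) , refl
oneLetterMultiplicities {0} {3} _ _ _ = 1 , 1 , from-yes (1 ≤? 2) , from-yes (2 <? 8) , refl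
oneLetterMultiplicities {1} {2} _ _ _ = 1 , 1 , from-yes (1 ≤? 2) , from-yes (2 <? 8) , refl
oneLetterMultiplicities {1} {3} _ _ _ = 3 , 1 , from-yes (1 ≤? 4) , from-yes (4 <? 8) , refl
oneLetterMultiplicities {suc (suc _)} (s≤s ())
oneLetterMultiplicities {kw = 0} _ ()
oneLetterMultiplicities {kw = 1} _ (s≤s ())
oneLetterMultiplicities {kw = suc (suc (suc (suc _)))} _ _ (s≤s (s≤s (s≤s ())))

cube-3-regular : ∀ ℓ v → length (labelsAt cube ℓ v) ≡ 3
cube-3-regular ℓ zero = refl
cube-3-regular ℓ (suc zero) = refl
cube-3-regular ℓ (suc (suc zero)) = refl
cube-3-regular ℓ (suc (suc (suc zero))) = refl
cube-3-regular ℓ (suc (suc (suc (suc zero)))) = refl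
cube-3-regular ℓ (suc (suc (suc (suc (suc zero))))) = refl
cube-3-regular ℓ (suc (suc (suc (suc (suc (suc zero)))))) = refl
cube-3-regular ℓ (suc (suc (suc (suc (suc (suc (suc zero))))))) = refl

module _ {P : Pot} (sc : Scenario2 P cube) where

  private
    ℓ : AssemblyDesign cube
    ℓ = proj₁ (proj₁ sc)

    lab : Fin 8 → Tile
    lab = labelsAt cube ℓ

    count<4 : ∀ x v → count x (lab v) < 4
    count<4 x v = s≤s (subst (count x (lab v) ≤_) (cube-3-regular ℓ v) (count≤length x (lab v)))

    real : ∀ v → PotTile P (lab v)
    real = proj₂ (proj₁ sc)

    tileOf : Fin 8 → Tile
    tileOf v = proj₁ (real v)

    sameTile : ∀ {v u} → tileOf v ≡ tileOf u → lab v ↭ lab u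
    sameTile {v} {u} eq =
      ↭-trans (proj₂ (proj₂ (real v))) (subst (_↭ lab u) (sym eq) (↭-sym (proj₂ (proj₂ (real u)))))

  no-small-copies : ∀ u w p q → 1 ≤ p + q → p + q < 8 →
    Balanced (concat (replicate p (lab u) ++ replicate q (lab w))) → ⊥
  no-small-copies u w p q nonempty small bal =
    <⇒≱ small (subst (8 ≤_) size
      (family-bound {P = P} {G = cube} sc family (subst (1 ≤_) (sym size) nonempty) fromPot bal))
    where
    family : List Tile
    family = replicate p (lab u) ++ replicate q (lab w)
    size : length family ≡ p + q
    size = trans (length-++ (replicate p (lab u))) (cong₂ _+_ (length-replicate p) (length-replicate q))
    fromPot : All (PotTile P) family
    fromPot = All-++⁺ (replicate⁺ p (real u)) (replicate⁺ q (real w))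

  two-kinds-impossible : ∀ u w → (∀ v → lab v ↭ lab u ⊎ lab v ↭ lab w) → ⊥
  two-kinds-impossible u w kind with two-kinds (tabulate lab) (tabulate⁺ kind)
  ... | m , m′ , m+m′≡8 , perm with reduce-two-kinds (s≤s (subst (m ≤_) m+m′≡8 (m≤m+n m m′)))
  ... | p , q , nonempty , small , reduce = no-small-copies u w p q nonempty small reduced
    where
    m′≡8∸m : m′ ≡ 8 ∸ m
    m′≡8∸m = sym (trans (cong (_∸ m) (sym m+m′≡8)) (m+n∸m≡n m m′))
    counts : ∀ x → count x (concat (tabulate lab)) ≡ m * count x (lab u) + (8 ∸ m) * count x (lab w)
    counts x = trans (count-↭ x perm) (trans (cong (count x) (concat-++ (replicate m (lab u)) _))
                 (trans (count-copies x m (lab u) m′ (lab w))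
                        (cong (λ n → m * count x (lab u) + n * count x (lab w)) m′≡8∸m)))
    reduced : Balanced (concat (replicate p (lab u) ++ replicate q (lab w)))
    reduced x = trans (count-copies x p (lab u) q (lab w))
      (trans (reduce (count<4 x u) (count<4 x w) (count<4 (hat x) u) (count<4 (hat x) w)
                (trans (sym (counts x)) (trans (handshake cube ℓ x) (counts (hat x)))))
             (sym (count-copies (hat x) p (lab u) q (lab w))))

  #T≥3 : 3 ≤ #T P
  #T≥3 = ≮⇒≥ few-impossible
    where
    few-impossible : #T P < 3 → ⊥
    few-impossible few with all? (λ v → ≡-decᴸ _≟ᶜ_ (tileOf v) (tileOf zero))
    ... | yes same = two-kinds-impossible zero zero (inj₁ ∘ sameTile ∘ same)
    ... | no differ with ¬∀⟶∃¬ 8 _ (λ v → ≡-decᴸ _≟ᶜ_ (tileOf v) (tileOf zero)) differ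
    ... | w , w≢0 = two-kinds-impossible zero w λ v →
      ⊎-map sameTile sameTile
        (≤2-dichotomy (≤-pred few) (tile∈ zero) (tile∈ w) (w≢0 ∘ sym) (tile∈ v))
      where
      tile∈ : ∀ v → tileOf v ∈ tiles P
      tile∈ v = proj₁ (proj₂ (real v))

  module _ (a : BondEdgeType) (oneLetter : ∀ v → OneLetter a (lab v)) where
    private
      F K : Fin 8 → ℕ
      F v = count (a , false) (lab v)
      K v = count (a , true) (lab v)

      F≡3∸K : ∀ v → F v ≡ 3 ∸ K v
      F≡3∸K v = trans (sym (m+n∸n≡m (F v) (K v)))
                      (cong (_∸ K v) (trans (count-OneLetter (lab v) (oneLetter v)) (cube-3-regular ℓ v)))

      K≤3 : ∀ v → K v ≤ 3
      K≤3 v = ≤-pred (count<4 (a , true) v)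

      handshake-a : count (a , false) (concat (tabulate lab)) ≡ count (a , true) (concat (tabulate lab))
      handshake-a = handshake cube ℓ (a , false)

      k<3∸k : ∀ {k} → k ≤ 1 → k < 3 ∸ k
      k<3∸k {0} _ = s≤s z≤n
      k<3∸k {1} _ = s≤s (s≤s z≤n)
      k<3∸k {suc (suc _)} (s≤s ())

      3∸k<k : ∀ {k} → 2 ≤ k → 3 ∸ k < k
      3∸k<k {suc (suc k)} _ = s≤s (≤-trans (m∸n≤m 1 k) (s≤s z≤n))
      3∸k<k {1} (s≤s ())

    oneLetter-impossible : ⊥
    oneLetter-impossible with any? (λ v → K v ≤? 1) | any? (λ v → 2 ≤? K v)
    ... | no noLow | _ =
      <⇒≢ (count-concat-< (a , false) (a , true) (lab zero) (tabulate (lab ∘ suc)) (tabulate⁺ {f = lab} Flow)) handshake-a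
      where
      Flow : ∀ v → F v < K v
      Flow v = subst (_< K v) (sym (F≡3∸K v)) (3∸k<k (≰⇒> (noLow ∘ (v ,_))))
    ... | _ | no noHigh =
      <⇒≢ (count-concat-< (a , true) (a , false) (lab zero) (tabulate (lab ∘ suc)) (tabulate⁺ {f = lab} Khigh))
          (sym handshake-a)
      where
      Khigh : ∀ v → K v < F v
      Khigh v = subst (K v <_) (sym (F≡3∸K v)) (k<3∸k (≤-pred (≰⇒> (noHigh ∘ (v ,_)))))
    ... | yes (u , low) | yes (w , high) with oneLetterMultiplicities low high (K≤3 w)
    ... | p , q , nonempty , small , eq = no-small-copies u w p q nonempty small
      (OneLetter-Balanced oneLetterFamily (trans (count-copies (a , false) p (lab u) q (lab w))
        (trans (cong₂ (λ fu fw → p * fu + q * fw) (F≡3∸K u) (F≡3∸K w))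
          (trans eq (sym (count-copies (a , true) p (lab u) q (lab w)))))))
      where
      oneLetterFamily : OneLetter a (concat (replicate p (lab u) ++ replicate q (lab w)))
      oneLetterFamily = OneLetter-concat (All-++⁺ (replicate⁺ p (oneLetter u)) (replicate⁺ q (oneLetter w)))

  #Σ≥2 : 2 ≤ #Σ P
  #Σ≥2 = ≮⇒≥ few-impossible
    where
    letter∈ : ∀ v {y} → y ∈ lab v → proj₁ y ∈ deduplicate _≟ℕ_ (map proj₁ (concat (tiles P)))
    letter∈ v y∈ =
      ∈-deduplicate⁺ _≟ℕ_ (∈-map⁺ proj₁ (∈-concat⁺′ (∈-resp-↭ (proj₂ (proj₂ (real v))) y∈) (proj₁ (proj₂ (real v)))))
    few-impossible : #Σ P < 2 → ⊥
    few-impossible few = oneLetter-impossible (proj₁ (ℓ zero)) -- ℓ zero is the first label at vertex 0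
      (λ v y∈ → ≤1-unique (≤-pred few) (letter∈ v y∈) (letter∈ zero (here refl)))

closed-by-concat : ∀ {ts : List Tile} → All (λ x → hat x ∈ concat ts) (concat ts) →
  ∀ t x → t ∈ ts → x ∈ t → ∃[ t′ ] (t′ ∈ ts × hat x ∈ t′)
closed-by-concat {ts} hats t x t∈ x∈ with ∈-concat⁻′ ts (All.lookup hats (∈-concat⁺′ x∈ t∈))
... | t′ , hx∈t′ , t′∈ = t′ , t′∈ , hx∈t′

count-distinguishes : ∀ x {s t} → count x s ≢ count x t → ¬ (s ↭ t)
count-distinguishes x differ = differ ∘ count-↭ x

A Â B B̂ : CohesiveEnd
A = 0 , false
Â = 0 , true
B = 1 , false
B̂ = 1 , true

t₁ t₂ t₃ : Tile
t₁ = A ∷ A ∷ A ∷ []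
t₂ = Â ∷ B ∷ B ∷ []
t₃ = Â ∷ B̂ ∷ B̂ ∷ []

tiles₀ : List Tile
tiles₀ = t₁ ∷ t₂ ∷ t₃ ∷ []

P₀ : Pot
P₀ = record
  { tiles    = tiles₀
  ; distinct = (count-distinguishes A (λ ()) ∷ count-distinguishes A (λ ()) ∷ [])
             ∷ (count-distinguishes B (λ ()) ∷ []) ∷ [] ∷ []
  ; closed   = closed-by-concat (from-yes (All.all? (λ x → Any.any? (hat x ≟ᶜ_) (concat tiles₀)) (concat tiles₀)))
  }

design₀ : AssemblyDesign cube
design₀ = lookupᵛ (A ∷ᵛ B ∷ᵛ B ∷ᵛ Â ∷ᵛ A ∷ᵛ B ∷ᵛ B ∷ᵛ Â ∷ᵛ A ∷ᵛ B ∷ᵛ B ∷ᵛ Â ∷ᵛ []ᵛ)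

P₀-realizes-cube : Realizes P₀ cube
P₀-realizes-cube = design₀ , λ where
  zero → t₁ , here refl , ↭-refl
  (suc zero) → t₂ , there (here refl) , ↭-refl
  (suc (suc zero)) → t₂ , there (here refl) , swap B Â ↭-refl
  (suc (suc (suc zero))) → t₃ , there (there (here refl)) , shift Â (B̂ ∷ B̂ ∷ []) []
  (suc (suc (suc (suc zero)))) → t₂ , there (here refl) , shift Â (B ∷ B ∷ []) []
  (suc (suc (suc (suc (suc zero))))) → t₃ , there (there (here refl)) , swap B̂ Â ↭-refl
  (suc (suc (suc (suc (suc (suc zero)))))) → t₃ , there (there (here refl)) , ↭-refl
  (suc (suc (suc (suc (suc (suc (suc zero))))))) → t₁ , here refl , ↭-refl

eight-divides : ∀ s₁ s₂ s₃ → s₁ * 3 ≡ s₂ + s₃ → s₂ * 2 ≡ s₃ * 2 → 8 ∣ s₁ + (s₂ + s₃)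
eight-divides s₁ s₂ s₃ A-balance B-balance with *-cancelʳ-≡ s₂ s₃ 2 B-balance
... | refl
  with coprime-divisor {o = s₁} (from-yes (coprime? 2 3)) (divides s₂ (trans (*-comm 3 s₁) (trans A-balance (double s₂))))
  where
  double : ∀ n → n + n ≡ n * 2
  double = solve-∀
... | divides r refl = divides r (trans (cong (r * 2 +_) (sym A-balance)) (octuple r))
  where
  octuple : ∀ n → n * 2 + n * 2 * 3 ≡ n * 8
  octuple = solve-∀

P₀-kind : ∀ {s} → PotTile P₀ s → s ↭ t₁ ⊎ (s ↭ t₂ ⊎ s ↭ t₃)
P₀-kind (_ , here refl , p) = inj₁ p
P₀-kind (_ , there (here refl) , p) = inj₂ (inj₁ p)
P₀-kind (_ , there (there (here refl)) , p) = inj₂ (inj₂ p)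

P₀-order-divisible : ∀ H → Realizes P₀ H → 8 ∣ nV H
P₀-order-divisible H (ℓ , real) with split-kind (tabulate (labelsAt H ℓ)) (tabulate⁺ (P₀-kind ∘ real))
... | s₁ , rest , kinds , len₁ , perm₁ with two-kinds rest kinds
... | s₂ , s₃ , len₂ , perm₂ = subst (8 ∣_) order (eight-divides s₁ s₂ s₃ A-balance B-balance)
  where
  counts : ∀ x → count x (total (labelsAt H ℓ)) ≡ s₁ * count x t₁ + (s₂ * count x t₂ + s₃ * count x t₃)
  counts x = begin
    count x (total (labelsAt H ℓ))
      ≡⟨ count-↭ x (↭-trans perm₁ (++⁺ˡ _ perm₂)) ⟩
    count x (concat (replicate s₁ t₁) ++ concat (replicate s₂ t₂) ++ concat (replicate s₃ t₃))
      ≡⟨ count-++ x (concat (replicate s₁ t₁)) _ ⟩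
    count x (concat (replicate s₁ t₁)) + count x (concat (replicate s₂ t₂) ++ concat (replicate s₃ t₃))
      ≡⟨ cong₂ _+_ (count-replicate x s₁ t₁)
                   (trans (cong (count x) (concat-++ (replicate s₂ t₂) _)) (count-copies x s₂ t₂ s₃ t₃)) ⟩
    s₁ * count x t₁ + (s₂ * count x t₂ + s₃ * count x t₃) ∎
    where open ≡-Reasoning
  balanced : ∀ x → s₁ * count x t₁ + (s₂ * count x t₂ + s₃ * count x t₃)
                 ≡ s₁ * count (hat x) t₁ + (s₂ * count (hat x) t₂ + s₃ * count (hat x) t₃)
  balanced x = trans (sym (counts x)) (trans (handshake H ℓ x) (counts (hat x)))
  A-balance : s₁ * 3 ≡ s₂ + s₃
  A-balance = trans (atA s₁ s₂ s₃) (trans (balanced A) (atÂ s₁ s₂ s₃))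
    where
    atA : ∀ a b c → a * 3 ≡ a * 3 + (b * 0 + c * 0)
    atA = solve-∀
    atÂ : ∀ a b c → a * 0 + (b * 1 + c * 1) ≡ b + c
    atÂ = solve-∀
  B-balance : s₂ * 2 ≡ s₃ * 2
  B-balance = trans (atB s₁ s₂ s₃) (trans (balanced B) (atB̂ s₁ s₂ s₃))
    where
    atB : ∀ a b c → b * 2 ≡ a * 0 + (b * 2 + c * 0)
    atB = solve-∀
    atB̂ : ∀ a b c → a * 0 + (b * 0 + c * 2) ≡ c * 2
    atB̂ = solve-∀
  order : s₁ + (s₂ + s₃) ≡ nV H
  order = trans (cong (s₁ +_) len₂) (trans len₁ (length-tabulate (labelsAt H ℓ)))

P₀-minimal : ∀ H → nV H ≥ 1 → Realizes P₀ H → nV H ≥ 8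
P₀-minimal H nonempty realized = ∣⇒≤ {{>-nonZero nonempty}} (P₀-order-divisible H realized)

proposition2 : (Σ[ P ∈ Pot ] (Scenario2 P cube × #T P ≡ 3 × #Σ P ≡ 2))
    × (∀ (P : Pot) → Scenario2 P cube → (#T P ≥ 3 × #Σ P ≥ 2))
proposition2 = (P₀ , (P₀-realizes-cube , P₀-minimal) , refl , refl) , λ P sc → #T≥3 {P} sc , #Σ≥2 {P} sc
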